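{- Let $P_1$ and $P_2$ be combinatorial propositions and let $Q$ be a combinatorial proposition or the empty graph (all with pairwise disjoint vertex sets). Then $(P_1\wedge P_2)\vee Q$ is true if and only if both $P_1\vee Q$ and $P_2\vee Q$ are true.
   Context: A graph $(V,E)$: finite $V$, $E$ a set of two-element subsets of $V$; write $vw$. For disjoint vertex sets, union $G\vee H=(V(G)\cup V(H),E(G)\cup E(H))$ and join $G\wedge H$ which additionally contains all edges between $V(G)$ and $V(H)$; labels inherited. The empty graph has no vertices. A cograph is a graph with nonempty vertex set such that for distinct $v,w,x,y$ the edges among $\{v,w,x,y\}$ are not exactly $\{vw,wx,xy\}$. Atoms: literals $p,\overline p$ (variables $p$) and constants $0,1$; $p,\overline p$ dual. A combinatorial proposition is a cograph with an atom label on each vertex. A stable set contains no edge; a clause is a maximal stable set; a clause is true if it contains a $1$-labelled vertex or two vertices labelled by dual literals; a labelled graph is true if all its clauses are true. -}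

module Defs where

open import Data.Nat using (ℕ; _≥_; _+_)
open import Data.Bool using (Bool; true; false)
open import Data.Fin using (Fin; splitAt)
open import Data.Sum using (_⊎_; inj₁; inj₂)
open import Data.Product using (_×_; ∃-syntax)
open import Relation.Binary.PropositionalEquality using (_≡_; _≢_)
open import Relation.Nullary using (¬_)

data Atom : Set where
  pos  : ℕ → Atom
  neg  : ℕ → Atom
  zer  : Atom
  one  : Atom

data Dual : Atom → Atom → Set where
  pos-neg : ∀ p → Dual (pos p) (neg p)
  neg-pos : ∀ p → Dual (neg p) (pos p)

-- Edges are given by a Bool-valued adjacency relation; 'IsGraph' demands
-- it is symmetric and irreflexive, i.e. it is a set of 2-element subsets.
record LGraph : Set where
  constructor mkLGraph
  field
    size  : ℕ
    adj   : Fin size → Fin size → Bool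
    label : Fin size → Atom
open LGraph public

IsGraph : LGraph → Set
IsGraph G = (∀ v w → adj G v w ≡ adj G w v) × (∀ v → adj G v v ≡ false)

Edge : (G : LGraph) → Fin (size G) → Fin (size G) → Set
Edge G v w = adj G v w ≡ true

IsEmpty : LGraph → Set
IsEmpty G = size G ≡ 0

-- Union and join of graphs with disjoint vertex sets: the vertex set of the
-- result is the disjoint union Fin (m + n) (first m vertices from G, rest from H);
-- labels are inherited.
unionAdj : (G H : LGraph) → Bool → Fin (size G + size H) → Fin (size G + size H) → Bool
unionAdj G H b i j with splitAt (size G) i | splitAt (size G) j
... | inj₁ a | inj₁ c = adj G a c
... | inj₂ a | inj₂ c = adj H a c
... | inj₁ _ | inj₂ _ = b
... | inj₂ _ | inj₁ _ = b

combLabel : (G H : LGraph) → Fin (size G + size H) → Atom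
combLabel G H i with splitAt (size G) i
... | inj₁ a = label G a
... | inj₂ a = label H a

_∨G_ : LGraph → LGraph → LGraph
G ∨G H = mkLGraph (size G + size H) (unionAdj G H false) (combLabel G H)

_∧G_ : LGraph → LGraph → LGraph
G ∧G H = mkLGraph (size G + size H) (unionAdj G H true) (combLabel G H)

infixr 6 _∧G_
infixr 5 _∨G_

-- Cograph: a graph with nonempty vertex set and no induced P4, i.e. for
-- distinct v,w,x,y the edges among {v,w,x,y} are not exactly {vw,wx,xy}.
IsCograph : LGraph → Set
IsCograph G =
  IsGraph G × size G ≥ 1 ×
  (∀ v w x y → v ≢ w → v ≢ x → v ≢ y → w ≢ x → w ≢ y → x ≢ y →
     ¬ (Edge G v w × Edge G w x × Edge G x y ×
        ¬ Edge G v x × ¬ Edge G v y × ¬ Edge G w y))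

CombProp : LGraph → Set
CombProp = IsCograph

Subset : LGraph → Set
Subset G = Fin (size G) → Bool

_∈S_ : ∀ {G} → Fin (size G) → Subset G → Set
v ∈S S = S v ≡ true

Stable : (G : LGraph) → Subset G → Set
Stable G S = ∀ v w → _∈S_ {G} v S → _∈S_ {G} w S → ¬ Edge G v w

Clause : (G : LGraph) → Subset G → Set
Clause G S = Stable G S ×
  (∀ T → Stable G T → (∀ v → _∈S_ {G} v S → _∈S_ {G} v T) →
         ∀ v → _∈S_ {G} v T → _∈S_ {G} v S)

ClauseTrue : (G : LGraph) → Subset G → Set
ClauseTrue G S =
  (∃[ v ] (_∈S_ {G} v S × label G v ≡ one)) ⊎
  (∃[ v ] ∃[ w ] (_∈S_ {G} v S × _∈S_ {G} w S × Dual (label G v) (label G w)))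

IsTrue : LGraph → Set
IsTrue G = ∀ S → Clause G S → ClauseTrue G S

-- P₁ ∨ Q and P₂ ∨ Q are induced labelled subgraphs of (P₁ ∧ P₂) ∨ Q.  A clause
-- either contains a given vertex or contains one of its neighbours, and the
-- neighbours of a vertex of P₁ lie in P₁ ∧ P₂; hence every clause of P₁ ∨ Q meets P₁,
-- and every clause of (P₁ ∧ P₂) ∨ Q meets P₁ or P₂ (but not both, being stable).
-- Since each vertex of P₂ is adjacent to all of P₁, a stable set meeting P₁ is a
-- clause of P₁ ∨ Q exactly when it is a clause of (P₁ ∧ P₂) ∨ Q, and the clause
-- truth of the two sides agrees because labels are inherited.
module Submission where

open import Defs
open import Data.Bool using (Bool; true; false; _∨_)
open import Data.Bool.Properties using (∨-zeroʳ) renaming (_≟_ to _≟ᵇ_)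
open import Data.Empty using (⊥-elim)
open import Data.Fin using (Fin; splitAt; _↑ˡ_; _↑ʳ_; fromℕ<)
open import Data.Fin.Properties using (any?; _≟_; splitAt-↑ˡ; splitAt-↑ʳ; splitAt⁻¹-↑ˡ; splitAt⁻¹-↑ʳ)
open import Data.Maybe using (Maybe; just; nothing; maybe)
import Data.Maybe as Maybe
open import Data.Nat using (ℕ; _+_)
open import Data.Product using (_×_; _,_; ∃-syntax)
open import Data.Sum using (_⊎_; inj₁; inj₂; [_,_]′)
open import Function using (_∘_; case_of_)
open import Function.Bundles using (_⇔_; mk⇔)
open import Relation.Binary.PropositionalEquality
open import Relation.Nullary using (¬_; yes; no; does)
open import Relation.Nullary.Decidable using (dec-true; _×-dec_; _⊎-dec_)

data SplitView (m n : ℕ) : Fin (m + n) → Set where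
  left  : (a : Fin m) → SplitView m n (a ↑ˡ n)
  right : (c : Fin n) → SplitView m n (m ↑ʳ c)

splitView : ∀ m n (x : Fin (m + n)) → SplitView m n x
splitView m n x with splitAt m x in eq
... | inj₁ a = subst (SplitView m n) (splitAt⁻¹-↑ˡ eq) (left a)
... | inj₂ c = subst (SplitView m n) (splitAt⁻¹-↑ʳ eq) (right c)

↑ʳ≢↑ˡ : ∀ {m n} (c : Fin n) (a : Fin m) → m ↑ʳ c ≢ a ↑ˡ n
↑ʳ≢↑ˡ {m} {n} c a eq
  with () ← trans (sym (splitAt-↑ʳ m n c)) (trans (cong (splitAt m) eq) (splitAt-↑ˡ m a n))

module _ (A B : LGraph) (b : Bool) where
  private
    m = size A
    n = size B

  unionAdj-↑ˡ-↑ˡ : ∀ a c → unionAdj A B b (a ↑ˡ n) (c ↑ˡ n) ≡ adj A a c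
  unionAdj-↑ˡ-↑ˡ a c rewrite splitAt-↑ˡ m a n | splitAt-↑ˡ m c n = refl

  unionAdj-↑ˡ-↑ʳ : ∀ a c → unionAdj A B b (a ↑ˡ n) (m ↑ʳ c) ≡ b
  unionAdj-↑ˡ-↑ʳ a c rewrite splitAt-↑ˡ m a n | splitAt-↑ʳ m n c = refl

  unionAdj-↑ʳ-↑ˡ : ∀ c a → unionAdj A B b (m ↑ʳ c) (a ↑ˡ n) ≡ b
  unionAdj-↑ʳ-↑ˡ c a rewrite splitAt-↑ʳ m n c | splitAt-↑ˡ m a n = refl

  unionAdj-↑ʳ-↑ʳ : ∀ c d → unionAdj A B b (m ↑ʳ c) (m ↑ʳ d) ≡ adj B c d
  unionAdj-↑ʳ-↑ʳ c d rewrite splitAt-↑ʳ m n c | splitAt-↑ʳ m n d = refl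

module _ (A B : LGraph) where

  combLabel-↑ˡ : ∀ a → combLabel A B (a ↑ˡ size B) ≡ label A a
  combLabel-↑ˡ a rewrite splitAt-↑ˡ (size A) a (size B) = refl

  combLabel-↑ʳ : ∀ c → combLabel A B (size A ↑ʳ c) ≡ label B c
  combLabel-↑ʳ c rewrite splitAt-↑ʳ (size A) (size B) c = refl

Adjacent : (G : LGraph) → Fin (size G) → Fin (size G) → Set
Adjacent G u v = Edge G u v ⊎ Edge G v u

module _ {G : LGraph} {S : Subset G} {u : Fin (size G)} where

  clause-∋-nonadjacent : Clause G S → ¬ Edge G u u →
                         (∀ v → S v ≡ true → ¬ Adjacent G u v) → S u ≡ true
  clause-∋-nonadjacent (stable , maximal) uu nonadj =
    maximal S∪u S∪u-stable (λ v Sv → cong (_∨ _) Sv) u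
            (trans (cong (S u ∨_) (dec-true (u ≟ u) refl)) (∨-zeroʳ (S u)))
    where
    S∪u : Subset G
    S∪u v = S v ∨ does (v ≟ u)

    ∈S∪u⁻ : ∀ v → S∪u v ≡ true → S v ≡ true ⊎ v ≡ u
    ∈S∪u⁻ v e with S v | v ≟ u
    ... | true  | _     = inj₁ refl
    ... | false | yes p = inj₂ p

    S∪u-stable : Stable G S∪u
    S∪u-stable v w Tv Tw vw with ∈S∪u⁻ v Tv | ∈S∪u⁻ w Tw
    ... | inj₁ Sv   | inj₁ Sw   = stable v w Sv Sw vw
    ... | inj₁ Sv   | inj₂ refl = nonadj v Sv (inj₂ vw)
    ... | inj₂ refl | inj₁ Sw   = nonadj w Sw (inj₁ vw)
    ... | inj₂ refl | inj₂ refl = uu vw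

  clause-meets-closedNeighbourhood : Clause G S → ¬ Edge G u u →
                                     ∃[ v ] (S v ≡ true × (v ≡ u ⊎ Adjacent G u v))
  clause-meets-closedNeighbourhood clause uu
    with any? (λ v → (S v ≟ᵇ true) ×-dec ((adj G u v ≟ᵇ true) ⊎-dec (adj G v u ≟ᵇ true)))
  ... | yes (v , Sv , uv) = v , Sv , inj₂ uv
  ... | no ¬meets =
    u , clause-∋-nonadjacent clause uu (λ v Sv uv → ¬meets (v , Sv , uv)) , inj₁ refl

∨-clause-meets-left : ∀ {A C : LGraph} {S : Subset (A ∨G C)} {u : Fin (size A)} →
                      Clause (A ∨G C) S → ¬ Edge A u u → ∃[ a ] S (a ↑ˡ size C) ≡ true
∨-clause-meets-left {A} {C} {S} {u} clause uu
  with clause-meets-closedNeighbourhood {A ∨G C} {S} {u ↑ˡ size C} clause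
         (uu ∘ trans (sym (unionAdj-↑ˡ-↑ˡ A C false u u)))
... | v , Sv , near with splitView (size A) (size C) v
...   | left a = a , Sv
...   | right c with near
...     | inj₁ eq        = ⊥-elim (↑ʳ≢↑ˡ c u eq)
...     | inj₂ (inj₁ uc) with () ← trans (sym uc) (unionAdj-↑ˡ-↑ʳ A C false u c)
...     | inj₂ (inj₂ cu) with () ← trans (sym cu) (unionAdj-↑ʳ-↑ˡ A C false c u)

record Embedding (H G : LGraph) : Set where
  field
    embed          : Fin (size H) → Fin (size G)
    restrict       : Fin (size G) → Maybe (Fin (size H))
    adj-embed      : ∀ a b → adj G (embed a) (embed b) ≡ adj H a b
    label-embed    : ∀ a → label G (embed a) ≡ label H a
    restrict-embed : ∀ a → restrict (embed a) ≡ just a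
    embed-restrict : ∀ {x a} → restrict x ≡ just a → embed a ≡ x

module EmbeddingProperties {H G : LGraph} (E : Embedding H G) where
  open Embedding E

  image : Subset H → Subset G
  image S x = maybe S false (restrict x)

  preimage : Subset G → Subset H
  preimage T = T ∘ embed

  image-embed : ∀ S a → image S (embed a) ≡ S a
  image-embed S a = cong (maybe S false) (restrict-embed a)

  image⁻ : ∀ S x → image S x ≡ true → ∃[ a ] (embed a ≡ x × S a ≡ true)
  image⁻ S x Sx with restrict x in eq
  ... | just a = a , embed-restrict eq , Sx

  image-stable : ∀ {S} → Stable H S → Stable G (image S)
  image-stable {S} stable x y Sx Sy xy with image⁻ S x Sx | image⁻ S y Sy
  ... | a , refl , Sa | b , refl , Sb = stable a b Sa Sb (trans (sym (adj-embed a b)) xy)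

  preimage-stable : ∀ {T} → Stable G T → Stable H (preimage T)
  preimage-stable stable a b Ta Tb ab = stable (embed a) (embed b) Ta Tb (trans (adj-embed a b) ab)

  Absorbing : Subset H → Set
  Absorbing S = ∀ x → restrict x ≡ nothing → ∃[ a ] (S a ≡ true × Edge G (embed a) x)

  image-clause : ∀ {S} → Clause H S → Absorbing S → Clause G (image S)
  image-clause {S} (stable , maximal) absorbing = image-stable stable , image-maximal
    where
    image-maximal : ∀ T → Stable G T → (∀ x → image S x ≡ true → T x ≡ true) →
                    ∀ x → T x ≡ true → image S x ≡ true
    image-maximal T T-stable S⊆T x Tx with restrict x in eq
    ... | just a = maximal (preimage T) (preimage-stable T-stable)
                     (λ b Sb → S⊆T (embed b) (trans (image-embed S b) Sb)) a
                     (subst (λ y → T y ≡ true) (sym (embed-restrict eq)) Tx)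
    ... | nothing with absorbing x eq
    ...   | a , Sa , ax =
      ⊥-elim (T-stable (embed a) x (S⊆T (embed a) (trans (image-embed S a) Sa)) Tx ax)

  preimage-clause : ∀ {T} → Clause G T → Absorbing (preimage T) → Clause H (preimage T)
  preimage-clause {T} (stable , maximal) absorbing = preimage-stable stable , preimage-maximal
    where
    preimage-maximal : ∀ S → Stable H S → (∀ a → T (embed a) ≡ true → S a ≡ true) →
                       ∀ a → S a ≡ true → T (embed a) ≡ true
    preimage-maximal S S-stable T⊆S a Sa =
      maximal (image S) (image-stable S-stable) T⊆image (embed a) (trans (image-embed S a) Sa)
      where
      T⊆image : ∀ x → T x ≡ true → image S x ≡ true
      T⊆image x Tx with restrict x in eq
      ... | just b = T⊆S b (subst (λ y → T y ≡ true) (sym (embed-restrict eq)) Tx)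
      ... | nothing with absorbing x eq
      ...   | b , Tb , bx = ⊥-elim (stable (embed b) x Tb Tx bx)

  image-true : ∀ {S} → ClauseTrue G (image S) → ClauseTrue H S
  image-true {S} (inj₁ (x , Sx , x≡1)) with image⁻ S x Sx
  ... | a , refl , Sa = inj₁ (a , Sa , trans (sym (label-embed a)) x≡1)
  image-true {S} (inj₂ (x , y , Sx , Sy , dual)) with image⁻ S x Sx | image⁻ S y Sy
  ... | a , refl , Sa | b , refl , Sb =
    inj₂ (a , b , Sa , Sb , subst₂ Dual (label-embed a) (label-embed b) dual)

  preimage-true : ∀ {T} → ClauseTrue H (preimage T) → ClauseTrue G T
  preimage-true (inj₁ (a , Ta , a≡1)) = inj₁ (embed a , Ta , trans (label-embed a) a≡1)
  preimage-true (inj₂ (a , b , Ta , Tb , dual)) =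
    inj₂ (embed a , embed b , Ta , Tb , subst₂ Dual (sym (label-embed a)) (sym (label-embed b)) dual)

  isTrue-restrict : IsTrue G → (∀ S → Clause H S → Absorbing S) → IsTrue H
  isTrue-restrict G-true absorbing S clause =
    image-true (G-true (image S) (image-clause clause (absorbing S clause)))

  clauseTrue-extend : IsTrue H → ∀ {T} → Clause G T → Absorbing (preimage T) → ClauseTrue G T
  clauseTrue-extend H-true clause absorbing =
    preimage-true (H-true _ (preimage-clause clause absorbing))

open Embedding
open EmbeddingProperties using (Absorbing; isTrue-restrict; clauseTrue-extend)

Dominating : ∀ {H G} → Embedding H G → Set
Dominating {G = G} E = ∀ a x → restrict E x ≡ nothing → Edge G (embed E a) x

∧-embedˡ : ∀ {A B} → Embedding A (A ∧G B)
∧-embedˡ {A} {B} = record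
  { embed          = _↑ˡ size B
  ; restrict       = [ just , (λ _ → nothing) ]′ ∘ splitAt (size A)
  ; adj-embed      = unionAdj-↑ˡ-↑ˡ A B true
  ; label-embed    = combLabel-↑ˡ A B
  ; restrict-embed = λ a → cong [ just , _ ]′ (splitAt-↑ˡ (size A) a (size B))
  ; embed-restrict = λ {x} → embed-restrict′ x (splitView (size A) (size B) x)
  }
  where
  embed-restrict′ : ∀ x {a} → SplitView (size A) (size B) x →
                    [ just , (λ _ → nothing) ]′ (splitAt (size A) x) ≡ just a → a ↑ˡ size B ≡ x
  embed-restrict′ _ (left a) eq
    rewrite splitAt-↑ˡ (size A) a (size B) with refl ← eq = refl
  embed-restrict′ _ (right c) eq
    rewrite splitAt-↑ʳ (size A) (size B) c with () ← eq

∧-embedʳ : ∀ {A B} → Embedding B (A ∧G B)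
∧-embedʳ {A} {B} = record
  { embed          = size A ↑ʳ_
  ; restrict       = [ (λ _ → nothing) , just ]′ ∘ splitAt (size A)
  ; adj-embed      = unionAdj-↑ʳ-↑ʳ A B true
  ; label-embed    = combLabel-↑ʳ A B
  ; restrict-embed = λ c → cong [ _ , just ]′ (splitAt-↑ʳ (size A) (size B) c)
  ; embed-restrict = λ {x} → embed-restrict′ x (splitView (size A) (size B) x)
  }
  where
  embed-restrict′ : ∀ x {c} → SplitView (size A) (size B) x →
                    [ (λ _ → nothing) , just ]′ (splitAt (size A) x) ≡ just c → size A ↑ʳ c ≡ x
  embed-restrict′ _ (left a) eq
    rewrite splitAt-↑ˡ (size A) a (size B) with () ← eq
  embed-restrict′ _ (right c) eq
    rewrite splitAt-↑ʳ (size A) (size B) c with refl ← eq = refl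

∧-embedˡ-dominating : ∀ {A B} → Dominating (∧-embedˡ {A} {B})
∧-embedˡ-dominating {A} {B} a x = dominating′ (splitView (size A) (size B) x)
  where
  dominating′ : ∀ {x} → SplitView (size A) (size B) x → restrict (∧-embedˡ {A} {B}) x ≡ nothing →
                Edge (A ∧G B) (a ↑ˡ size B) x
  dominating′ (left a′) eq with () ← trans (sym eq) (restrict-embed (∧-embedˡ {A} {B}) a′)
  dominating′ (right c) _ = unionAdj-↑ˡ-↑ʳ A B true a c

∧-embedʳ-dominating : ∀ {A B} → Dominating (∧-embedʳ {A} {B})
∧-embedʳ-dominating {A} {B} c x = dominating′ (splitView (size A) (size B) x)
  where
  dominating′ : ∀ {x} → SplitView (size A) (size B) x → restrict (∧-embedʳ {A} {B}) x ≡ nothing →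
                Edge (A ∧G B) (size A ↑ʳ c) x
  dominating′ (left a) _ = unionAdj-↑ʳ-↑ˡ A B true c a
  dominating′ (right c′) eq with () ← trans (sym eq) (restrict-embed (∧-embedʳ {A} {B}) c′)

module _ {A B : LGraph} (C : LGraph) (E : Embedding A B) where
  private
    m = size A
    n = size B
    k = size C

    embed′ : Fin (m + k) → Fin (n + k)
    embed′ = [ (λ a → embed E a ↑ˡ k) , n ↑ʳ_ ]′ ∘ splitAt m

    restrict′ : Fin (n + k) → Maybe (Fin (m + k))
    restrict′ = [ Maybe.map (_↑ˡ k) ∘ restrict E , just ∘ (m ↑ʳ_) ]′ ∘ splitAt n

    embed′-↑ˡ : ∀ a → embed′ (a ↑ˡ k) ≡ embed E a ↑ˡ k
    embed′-↑ˡ a rewrite splitAt-↑ˡ m a k = refl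

    embed′-↑ʳ : ∀ c → embed′ (m ↑ʳ c) ≡ n ↑ʳ c
    embed′-↑ʳ c rewrite splitAt-↑ʳ m k c = refl

    restrict′-↑ˡ : ∀ b → restrict′ (b ↑ˡ k) ≡ Maybe.map (_↑ˡ k) (restrict E b)
    restrict′-↑ˡ b rewrite splitAt-↑ˡ n b k = refl

    restrict′-↑ʳ : ∀ c → restrict′ (n ↑ʳ c) ≡ just (m ↑ʳ c)
    restrict′-↑ʳ c rewrite splitAt-↑ʳ n k c = refl

  ∨-embed : Embedding (A ∨G C) (B ∨G C)
  ∨-embed = record
    { embed          = embed′
    ; restrict       = restrict′
    ; adj-embed      = adj-embed′
    ; label-embed    = label-embed′
    ; restrict-embed = restrict-embed′
    ; embed-restrict = λ {x} → embed-restrict′ (splitView n k x)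
    }
    where
    adj-embed′ : ∀ x y → unionAdj B C false (embed′ x) (embed′ y) ≡ unionAdj A C false x y
    adj-embed′ x y with splitView m k x | splitView m k y
    ... | left a  | left b
      rewrite embed′-↑ˡ a | embed′-↑ˡ b
            | unionAdj-↑ˡ-↑ˡ B C false (embed E a) (embed E b) | unionAdj-↑ˡ-↑ˡ A C false a b
      = adj-embed E a b
    ... | left a  | right d
      rewrite embed′-↑ˡ a | embed′-↑ʳ d
            | unionAdj-↑ˡ-↑ʳ B C false (embed E a) d | unionAdj-↑ˡ-↑ʳ A C false a d = refl
    ... | right c | left b
      rewrite embed′-↑ʳ c | embed′-↑ˡ b
            | unionAdj-↑ʳ-↑ˡ B C false c (embed E b) | unionAdj-↑ʳ-↑ˡ A C false c b = refl
    ... | right c | right d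
      rewrite embed′-↑ʳ c | embed′-↑ʳ d
            | unionAdj-↑ʳ-↑ʳ B C false c d | unionAdj-↑ʳ-↑ʳ A C false c d = refl

    label-embed′ : ∀ x → combLabel B C (embed′ x) ≡ combLabel A C x
    label-embed′ x with splitView m k x
    ... | left a  rewrite embed′-↑ˡ a | combLabel-↑ˡ B C (embed E a) | combLabel-↑ˡ A C a = label-embed E a
    ... | right c rewrite embed′-↑ʳ c | combLabel-↑ʳ B C c | combLabel-↑ʳ A C c = refl

    restrict-embed′ : ∀ x → restrict′ (embed′ x) ≡ just x
    restrict-embed′ x with splitView m k x
    ... | left a  rewrite embed′-↑ˡ a | restrict′-↑ˡ (embed E a) | restrict-embed E a = refl
    ... | right c rewrite embed′-↑ʳ c | restrict′-↑ʳ c = refl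

    embed-restrict′ : ∀ {y x} → SplitView n k y → restrict′ y ≡ just x → embed′ x ≡ y
    embed-restrict′ (left b) eq rewrite restrict′-↑ˡ b with restrict E b in eqᴱ
    ... | just a with refl ← eq = trans (embed′-↑ˡ a) (cong (_↑ˡ k) (embed-restrict E eqᴱ))
    embed-restrict′ (right c) eq rewrite restrict′-↑ʳ c with refl ← eq = embed′-↑ʳ c

  ∨-embed-↑ˡ : ∀ a → embed ∨-embed (a ↑ˡ k) ≡ embed E a ↑ˡ k
  ∨-embed-↑ˡ = embed′-↑ˡ

  ∨-embed-absorbing : Dominating E → ∀ {S a} → S (a ↑ˡ k) ≡ true →
                      Absorbing ∨-embed S
  ∨-embed-absorbing dominating {S} {a} Sa y = absorbing′ (splitView n k y)
    where
    absorbing′ : ∀ {y} → SplitView n k y → restrict′ y ≡ nothing →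
                 ∃[ x ] (S x ≡ true × unionAdj B C false (embed′ x) y ≡ true)
    absorbing′ (left b) eq rewrite restrict′-↑ˡ b with restrict E b in eqᴱ
    ... | nothing = a ↑ˡ k , Sa ,
          trans (cong (λ x → unionAdj B C false x (b ↑ˡ k)) (embed′-↑ˡ a))
                (trans (unionAdj-↑ˡ-↑ˡ B C false (embed E a) b) (dominating a b eqᴱ))
    absorbing′ (right c) eq with () ← trans (sym eq) (restrict′-↑ʳ c)

module _ {A B : LGraph} (C : LGraph) (E : Embedding A B) (dominating : Dominating E) where

  ∨-isTrue-restrict : ∀ {u} → ¬ Edge A u u → IsTrue (B ∨G C) → IsTrue (A ∨G C)
  ∨-isTrue-restrict uu B∨C-true = isTrue-restrict (∨-embed C E) B∨C-true absorbing
    where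
    absorbing : ∀ S → Clause (A ∨G C) S → Absorbing (∨-embed C E) S
    absorbing S clause with a , Sa ← ∨-clause-meets-left {A} {C} {S} clause uu
      = ∨-embed-absorbing C E dominating Sa

  ∨-clauseTrue-extend : IsTrue (A ∨G C) → ∀ {T a} → Clause (B ∨G C) T →
                        T (embed E a ↑ˡ size C) ≡ true → ClauseTrue (B ∨G C) T
  ∨-clauseTrue-extend A∨C-true {T} {a} clause Ta =
    clauseTrue-extend (∨-embed C E) A∨C-true clause
      (∨-embed-absorbing C E dominating (trans (cong T (∨-embed-↑ˡ C E a)) Ta))

looplessVertex : ∀ {P} → CombProp P → ∃[ u ] ¬ Edge P u u
looplessVertex ((_ , irreflexive) , nonempty , _) =
  fromℕ< nonempty , λ uu → case trans (sym uu) (irreflexive (fromℕ< nonempty)) of λ ()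

lemma9 : (P₁ P₂ Q : LGraph) → CombProp P₁ → CombProp P₂ → (CombProp Q ⊎ IsEmpty Q) →
    (IsTrue ((P₁ ∧G P₂) ∨G Q) ⇔ (IsTrue (P₁ ∨G Q) × IsTrue (P₂ ∨G Q)))
lemma9 P₁ P₂ Q cog₁ cog₂ _
  with u₁ , u₁u₁ ← looplessVertex {P₁} cog₁ | u₂ , u₂u₂ ← looplessVertex {P₂} cog₂ = mk⇔
  (λ G-true → ∨-isTrue-restrict Q ∧-embedˡ ∧-embedˡ-dominating u₁u₁ G-true
            , ∨-isTrue-restrict Q ∧-embedʳ ∧-embedʳ-dominating u₂u₂ G-true)
  (λ (H₁-true , H₂-true) → extend H₁-true H₂-true)
  where
  extend : IsTrue (P₁ ∨G Q) → IsTrue (P₂ ∨G Q) → IsTrue ((P₁ ∧G P₂) ∨G Q)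
  extend H₁-true H₂-true T clause
    with a , Ta ← ∨-clause-meets-left {P₁ ∧G P₂} {Q} {T} clause
                    (u₁u₁ ∘ trans (sym (unionAdj-↑ˡ-↑ˡ P₁ P₂ true u₁ u₁)))
    with splitView (size P₁) (size P₂) a
  ... | left a₁  = ∨-clauseTrue-extend Q ∧-embedˡ ∧-embedˡ-dominating H₁-true clause Ta
  ... | right a₂ = ∨-clauseTrue-extend Q ∧-embedʳ ∧-embedʳ-dominating H₂-true clause Ta
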